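{- Let $\mathbf{AT}=\{p\}$. There is no propositional formula $\varphi\in SENT(\mathbf{AT})$ that is equivalent to $\langle p\rangle\top$; that is, there is no $\varphi\in SENT(\{p\})$ such that for every Beth model $\Theta$ with root $\alpha$ one has $\alpha\Vdash\varphi$ if and only if $\alpha\not\Vdash\neg p$.
   Context: $SENT(\mathbf{AT})$ is the set of propositional formulas over $\mathbf{AT}$ built with $\neg,\wedge,\vee,\rightarrow$ (with $\top$ available as a formula such as $p\rightarrow p$). A Beth model is a triple $\Theta=\langle Q,\leq,F\rangle$ where $(Q,\leq)$ is a partial order with a least element (the root) and $F:Q\to 2^{\mathbf{AT}}$ satisfies $F(\alpha)\subseteq F(\beta)$ whenever $\alpha\leq\beta$. A path through $\alpha$ is a maximal linearly ordered subset containing $\alpha$; a bar for $\alpha$ is a subset meeting every path through $\alpha$. Forcing: $\alpha\Vdash q$ ($q$ atomic) iff there is a bar $B$ for $\alpha$ with $q\in F(\beta)$ for all $\beta\in B$; $\alpha\Vdash A\wedge B$ iff both hold; $\alpha\Vdash A\vee B$ iff there is a bar for $\alpha$ each of whose elements forces $A$ or forces $B$; $\alpha\Vdash A\rightarrow B$ iff every $\beta\geq\alpha$ forcing $A$ forces $B$; $\alpha\Vdash\neg A$ iff no $\beta\geq\alpha$ forces $A$. The announcement formula $\langle p\rangle\top$ is evaluated in a single Beth model (viewed as a Beth-Kripke model with one world $s$ whose root is $\alpha$): $(M,s)\models\langle\psi\rangle\chi$ iff $(M,s)\not\models\neg\psi$ and $(M|_\psi,s)\models\chi$, where $M|_\psi$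 restricts the model to nodes not forcing $\neg\psi$; in particular the root $\alpha$ satisfies $\langle p\rangle\top$ iff $\alpha\not\Vdash\neg p$. -}

module Defs where

open import Level using (Level; 0ℓ) renaming (suc to lsuc)
open import Data.Bool using (Bool; true)
open import Data.Unit using (⊤; tt)
open import Data.Product using (Σ; _×_; _,_)
open import Data.Sum using (_⊎_)
open import Relation.Nullary using (¬_)
open import Relation.Binary.PropositionalEquality using (_≡_)
open import Relation.Binary.Structures using (IsPartialOrder)

data Formula (AT : Set) : Set where
  atom : AT → Formula AT
  ~_   : Formula AT → Formula AT
  _∧_  : Formula AT → Formula AT → Formula AT
  _∨_  : Formula AT → Formula AT → Formula AT
  _⇒_  : Formula AT → Formula AT → Formula AT

-- A Beth model over atoms AT: a partial order with a least element (root)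
-- and a monotone valuation F : Q → 2^AT (subsets of AT as AT → Bool).
record BethModel (AT : Set) : Set₁ where
  field
    Q       : Set
    _≤_     : Q → Q → Set
    isPO    : IsPartialOrder _≡_ _≤_
    root    : Q
    root-least : ∀ q → root ≤ q
    F       : Q → AT → Bool
    F-mono  : ∀ {a b} → a ≤ b → ∀ x → F a x ≡ true → F b x ≡ true

  Subset : Set₁
  Subset = Q → Set

  _⊆_ : Subset → Subset → Set
  S ⊆ T = ∀ q → S q → T q

  LinOrd : Subset → Set
  LinOrd S = ∀ x y → S x → S y → (x ≤ y) ⊎ (y ≤ x)

  IsPath : Q → Subset → Set₁
  IsPath α P = P α × LinOrd P × (∀ (P′ : Subset) → LinOrd P′ → P ⊆ P′ → P′ ⊆ P)

  IsBar : Q → Subset → Set₁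
  IsBar α B = ∀ (P : Subset) → IsPath α P → Σ Q (λ β → P β × B β)

  _⊩_ : Q → Formula AT → Set₁
  α ⊩ atom q  = Σ Subset (λ B → IsBar α B × (∀ β → B β → F β q ≡ true))
  α ⊩ (A ∧ B) = (α ⊩ A) × (α ⊩ B)
  α ⊩ (A ∨ B) = Σ Subset (λ C → IsBar α C × (∀ β → C β → (β ⊩ A) ⊎ (β ⊩ B)))
  α ⊩ (A ⇒ B) = ∀ β → α ≤ β → β ⊩ A → β ⊩ B
  α ⊩ (~ A)   = ∀ β → α ≤ β → ¬ (β ⊩ A)

p : Formula ⊤
p = atom tt

-- At a maximal node β whose predecessors form a chain, the chain ↓β is a path through
-- every γ ≤ β; hence forcing at β is classical truth in the valuation F β, and forcing
-- at any γ ≤ β implies that truth. In the model whose root lies below one leaf where p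
-- holds and one where it fails, the root does not force ¬p, so a φ equivalent to ⟨p⟩⊤
-- is forced there and is therefore classically true under p := false. But then φ is
-- also forced in the one-point model with p false, whose root forces ¬p.
module Submission where

open import Defs
open import Data.Bool using (Bool; true; false)
open import Data.Product using (Σ; _×_; _,_; proj₁; proj₂)
open import Data.Sum using (_⊎_; inj₁; inj₂)
import Data.Sum as Sum
open import Data.Unit using (⊤; tt)
open import Relation.Nullary using (¬_)
open import Relation.Binary.PropositionalEquality
  using (_≡_; refl; sym; subst; isEquivalence)
open import Relation.Binary.Structures using (IsPartialOrder)

private
  variable
    AT : Set

_⊨_ : (AT → Bool) → Formula AT → Set
v ⊨ atom q  = v q ≡ true
v ⊨ (~ A)   = ¬ (v ⊨ A)
v ⊨ (A ∧ B) = (v ⊨ A) × (v ⊨ B)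
v ⊨ (A ∨ B) = (v ⊨ A) ⊎ (v ⊨ B)
v ⊨ (A ⇒ B) = v ⊨ A → v ⊨ B

module _ (M : BethModel AT) where
  open BethModel M

  ↓ : Q → Subset
  ↓ β γ = γ ≤ β

  record IsLeaf (β : Q) : Set where
    field
      maximal   : ∀ {γ} → β ≤ γ → β ≡ γ
      ↓-linear  : LinOrd (↓ β)

  leaf-≥⇒≤ : ∀ {β γ} → IsLeaf β → β ≤ γ → γ ≤ β
  leaf-≥⇒≤ leaf β≤γ = IsPartialOrder.reflexive isPO (sym (IsLeaf.maximal leaf β≤γ))

  ≡-isBar : ∀ β → IsBar β (_≡ β)
  ≡-isBar β P (Pβ , _) = β , Pβ , refl

  ↓-isPath : ∀ {β γ} → IsLeaf β → γ ≤ β → IsPath γ (↓ β)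
  ↓-isPath {β} leaf γ≤β = γ≤β , IsLeaf.↓-linear leaf , ↓-maximal
    where
    ↓-maximal : ∀ P → LinOrd P → ↓ β ⊆ P → P ⊆ ↓ β
    ↓-maximal P linear ↓β⊆P δ Pδ with linear β δ (↓β⊆P β (IsPartialOrder.refl isPO)) Pδ
    ... | inj₁ β≤δ = leaf-≥⇒≤ leaf β≤δ
    ... | inj₂ δ≤β = δ≤β

  module Leaf {β : Q} (leaf : IsLeaf β) where
    open IsLeaf leaf using (maximal)
    open IsPartialOrder isPO using () renaming (refl to ≤-refl)

    mutual
      below-⊩⇒⊨ : ∀ {γ} φ → γ ≤ β → γ ⊩ φ → F β ⊨ φ
      below-⊩⇒⊨ (atom q) γ≤β (B , bar , B⊆q) with bar (↓ β) (↓-isPath leaf γ≤β)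
      ... | δ , δ≤β , Bδ = F-mono δ≤β q (B⊆q δ Bδ)
      below-⊩⇒⊨ (~ A) γ≤β γ⊩¬A β⊨A = γ⊩¬A β γ≤β (⊨⇒⊩ A β⊨A)
      below-⊩⇒⊨ (A ∧ B) γ≤β (γ⊩A , γ⊩B) = below-⊩⇒⊨ A γ≤β γ⊩A , below-⊩⇒⊨ B γ≤β γ⊩B
      below-⊩⇒⊨ (A ∨ B) γ≤β (C , bar , C⊆A∨B) with bar (↓ β) (↓-isPath leaf γ≤β)
      ... | δ , δ≤β , Cδ = Sum.map (below-⊩⇒⊨ A δ≤β) (below-⊩⇒⊨ B δ≤β) (C⊆A∨B δ Cδ)
      below-⊩⇒⊨ (A ⇒ B) γ≤β γ⊩A⇒B β⊨A = below-⊩⇒⊨ B ≤-refl (γ⊩A⇒B β γ≤β (⊨⇒⊩ A β⊨A))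

      ⊨⇒⊩ : ∀ φ → F β ⊨ φ → β ⊩ φ
      ⊨⇒⊩ (atom q) β⊨q = (_≡ β) , ≡-isBar β , λ { _ refl → β⊨q }
      ⊨⇒⊩ (~ A) β⊭A δ β≤δ δ⊩A = β⊭A (below-⊩⇒⊨ A (leaf-≥⇒≤ leaf β≤δ) δ⊩A)
      ⊨⇒⊩ (A ∧ B) (β⊨A , β⊨B) = ⊨⇒⊩ A β⊨A , ⊨⇒⊩ B β⊨B
      ⊨⇒⊩ (A ∨ B) β⊨A∨B = (_≡ β) , ≡-isBar β , λ { _ refl → Sum.map (⊨⇒⊩ A) (⊨⇒⊩ B) β⊨A∨B }
      ⊨⇒⊩ (A ⇒ B) β⊨A⇒B δ β≤δ δ⊩A =
        subst (_⊩ B) (maximal β≤δ)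
          (⊨⇒⊩ B (β⊨A⇒B (below-⊩⇒⊨ A (leaf-≥⇒≤ leaf β≤δ) δ⊩A)))

point : (AT → Bool) → BethModel AT
point v = record
  { Q          = ⊤
  ; _≤_        = λ _ _ → ⊤
  ; isPO       = record
    { isPreorder = record
      { isEquivalence = isEquivalence
      ; reflexive     = λ _ → tt
      ; trans         = λ _ _ → tt
      }
    ; antisym    = λ _ _ → refl
    }
  ; root       = tt
  ; root-least = λ _ → tt
  ; F          = λ _ → v
  ; F-mono     = λ _ _ vx → vx
  }

point-root-isLeaf : (v : AT → Bool) → IsLeaf (point v) tt
point-root-isLeaf v = record { maximal = λ _ → refl ; ↓-linear = λ _ _ _ _ → inj₁ tt }

data FanNode (I : Set) : Set where
  bottom : FanNode I
  tip    : I → FanNode I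

data _≤ᶠ_ {I : Set} : FanNode I → FanNode I → Set where
  bottom≤ : ∀ x → bottom ≤ᶠ x
  tip≤    : ∀ i → tip i ≤ᶠ tip i

-- The bottom carries the empty valuation, so monotonicity holds for any tip valuations.
fanValuation : {I : Set} → (I → AT → Bool) → FanNode I → AT → Bool
fanValuation v bottom  _ = false
fanValuation v (tip i)   = v i

fan : {I : Set} → (I → AT → Bool) → BethModel AT
fan v = record
  { Q          = FanNode _
  ; _≤_        = _≤ᶠ_
  ; isPO       = record
    { isPreorder = record
      { isEquivalence = isEquivalence
      ; reflexive     = λ { {bottom} refl → bottom≤ bottom ; {tip i} refl → tip≤ i }
      ; trans         = λ { (bottom≤ _) _ → bottom≤ _ ; (tip≤ _) x≤y → x≤y }
      }
    ; antisym    = λ { (bottom≤ bottom) _ → refl ; (bottom≤ (tip _)) () ; (tip≤ _) _ → refl }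
    }
  ; root       = bottom
  ; root-least = bottom≤
  ; F          = fanValuation v
  ; F-mono     = λ { (bottom≤ _) _ () ; (tip≤ _) _ vx → vx }
  }

fan-tip-isLeaf : {I : Set} (v : I → AT → Bool) (i : I) → IsLeaf (fan v) (tip i)
fan-tip-isLeaf v i = record { maximal = λ { (tip≤ _) → refl } ; ↓-linear = linear }
  where
  linear : BethModel.LinOrd (fan v) (↓ (fan v) (tip i))
  linear bottom y      _        _        = inj₁ (bottom≤ y)
  linear x      bottom _        _        = inj₂ (bottom≤ x)
  linear _      _      (tip≤ _) (tip≤ _) = inj₁ (tip≤ i)

p-is : Bool → ⊤ → Bool
p-is b _ = b

mainTheorem5 : ¬ Σ (Formula ⊤) (λ φ → (M : BethModel ⊤) →
                 let open BethModel M in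
                 ((root ⊩ φ) → ¬ (root ⊩ (~ p))) × (¬ (root ⊩ (~ p)) → (root ⊩ φ)))
mainTheorem5 (φ , φ↔◇p) = proj₁ (φ↔◇p (point (p-is false))) point⊩φ point⊩¬p
  where
  module Fan = BethModel (fan p-is)
  module Point = BethModel (point (p-is false))

  bottom⊮¬p : ¬ (bottom Fan.⊩ (~ p))
  bottom⊮¬p bottom⊩¬p = bottom⊩¬p (tip true) (bottom≤ (tip true))
    (Leaf.⊨⇒⊩ (fan p-is) (fan-tip-isLeaf p-is true) p refl)

  p-false⊨φ : p-is false ⊨ φ
  p-false⊨φ = Leaf.below-⊩⇒⊨ (fan p-is) (fan-tip-isLeaf p-is false) φ (bottom≤ (tip false))
    (proj₂ (φ↔◇p (fan p-is)) bottom⊮¬p)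

  point⊩φ : tt Point.⊩ φ
  point⊩φ = Leaf.⊨⇒⊩ (point (p-is false)) (point-root-isLeaf (p-is false)) φ p-false⊨φ

  point⊩¬p : tt Point.⊩ (~ p)
  point⊩¬p = Leaf.⊨⇒⊩ (point (p-is false)) (point-root-isLeaf (p-is false)) (~ p) λ ()
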